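{- Let $R=R^G_H(D)$ be a partial subdivision of $D$ and let $a,b,c\in V(R)$ with $b\in A(G)$ (i.e., $b$ is a subdivision vertex). If $W_1=(a=v_0,\dots,v_n=b)$ is an $H$-walk in $R$ and $W_2=(b=u_0,\dots,u_k=c)$ is an $H$-walk in $R$, then the concatenation $W_1\cup W_2=(v_0,\dots,v_n=u_0,u_1,\dots,u_k)$ is an $H$-walk in $R$.
   Context: $H$ is a digraph, possibly with loops. An $H$-colored digraph is a digraph (possibly infinite, without loops) with a coloring $c$ of its arcs by vertices of $H$. A walk $(v_0,\dots,v_n)$ is an $H$-walk if $(c(v_{i-1},v_i),c(v_i,v_{i+1}))\in A(H)$ for all $1\le i\le n-1$ (a single vertex and a single arc are $H$-walks). $D$ is a digraph without loops (possibly infinite) and $G$ is a spanning subdigraph of $D$ such that for every vertex $v$, $\delta^+_G(v)=0$ iff $\delta^+_D(v)=0$. The partial subdivision $R^G_H(D)$ is the $H$-colored digraph with vertex set $V(D)\cup A(G)$ (each arc of $G$ becomes a new vertex) and arc set $\{(u,a),(a,v): a=(u,v)\in A(G)\}\cup(A(D)\setminus A(G))$, colored so that for every $a=(u,v)\in A(G)$ the walk $(u,a,v)$ is an $H$-walk. -}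

module Defs where

open import Data.Empty using (⊥)
open import Data.Unit using (⊤)
open import Data.Product using (Σ; Σ-syntax; ∃; ∃-syntax; _×_; _,_)
open import Data.Sum using (_⊎_; inj₁; inj₂)
open import Relation.Nullary using (¬_)
open import Function.Bundles using (_⇔_)

record Digraph : Set₁ where
  field
    Vertex : Set
    Arc    : Vertex → Vertex → Set
open Digraph public

data Walk (D : Digraph) : Vertex D → Vertex D → Set where
  []  : ∀ {x} → Walk D x x
  _∷_ : ∀ {x y z} → Arc D x y → Walk D y z → Walk D x z

infixr 5 _∷_ _++_

_++_ : ∀ {D x y z} → Walk D x y → Walk D y z → Walk D x z
[]      ++ w₂ = w₂
(e ∷ w) ++ w₂ = e ∷ (w ++ w₂)

record HColored (H : Digraph) : Set₁ where
  field
    graph  : Digraph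
    colour : ∀ {x y} → Arc graph x y → Vertex H
open HColored public

data IsHWalk (H : Digraph) (R : HColored H) :
       ∀ {x y} → Walk (graph R) x y → Set where
  hw-nil : ∀ {x} → IsHWalk H R ([] {x = x})
  hw-one : ∀ {x y} (e : Arc (graph R) x y) → IsHWalk H R (e ∷ [])
  hw-cons : ∀ {x y z w} (e : Arc (graph R) x y) (e′ : Arc (graph R) y z)
              (p : Walk (graph R) z w) →
            Arc H (colour R e) (colour R e′) →
            IsHWalk H R (e′ ∷ p) → IsHWalk H R (e ∷ e′ ∷ p)

Loopless : Digraph → Set
Loopless D = ∀ v → ¬ Arc D v v

-- A spanning subdigraph G of D is given by the predicate InG on the arcs of D
-- (A(G) = arcs of D satisfying InG; V(G) = V(D)).
SubArcs : Digraph → Set₁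
SubArcs D = ∀ {u v} → Arc D u v → Set

-- δ⁺_G(v) = 0  iff  δ⁺_D(v) = 0, for every vertex v
-- (stated equivalently as: v has an out-arc in G iff v has an out-arc in D).
OutDegreeCondition : (D : Digraph) → SubArcs D → Set
OutDegreeCondition D InG =
  ∀ v → (∃[ w ] Σ[ a ∈ Arc D v w ] InG a) ⇔ (∃[ w ] Arc D v w)

-- Arcs of G, i.e. the subdivision vertices.
ArcG : (D : Digraph) → SubArcs D → Set
ArcG D InG = Σ[ u ∈ Vertex D ] Σ[ v ∈ Vertex D ] Σ[ a ∈ Arc D u v ] InG a

RVertex : (D : Digraph) → SubArcs D → Set
RVertex D InG = Vertex D ⊎ ArcG D InG

data RArc (D : Digraph) (InG : SubArcs D) : RVertex D InG → RVertex D InG → Set where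
  arc-in  : ∀ {u v} (a : Arc D u v) (g : InG a) →
            RArc D InG (inj₁ u) (inj₂ (u , v , a , g))
  arc-out : ∀ {u v} (a : Arc D u v) (g : InG a) →
            RArc D InG (inj₂ (u , v , a , g)) (inj₁ v)
  arc-old : ∀ {u v} (a : Arc D u v) → ¬ InG a →
            RArc D InG (inj₁ u) (inj₁ v)

RDigraph : (D : Digraph) → SubArcs D → Digraph
RDigraph D InG = record { Vertex = RVertex D InG ; Arc = RArc D InG }

RColored : (H D : Digraph) (InG : SubArcs D) →
           (∀ {x y} → RArc D InG x y → Vertex H) → HColored H
RColored H D InG c = record { graph = RDigraph D InG ; colour = c }

SubdivisionColouring : (H D : Digraph) (InG : SubArcs D) →
                       (∀ {x y} → RArc D InG x y → Vertex H) → Set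
SubdivisionColouring H D InG c =
  ∀ {u v} (a : Arc D u v) (g : InG a) →
  IsHWalk H (RColored H D InG c) (arc-in a g ∷ arc-out a g ∷ [])

module Submission where

open import Defs
open import Data.Sum using (inj₂)

-- The only new pair of consecutive arcs in W₁ ++ W₂ is the one meeting at b. A subdivision
-- vertex b = (u,v) has the single in-arc (u,b) and the single out-arc (b,v), and the
-- colouring condition makes exactly that pair H-adjacent.

module _ {H : Digraph} (R : HColored H) where

  Junction : Vertex (graph R) → Set
  Junction m = ∀ {x z} (e : Arc (graph R) x m) (e′ : Arc (graph R) m z) →
               Arc H (colour R e) (colour R e′)

  ++-isHWalk : ∀ {x m z} → Junction m →
               (W₁ : Walk (graph R) x m) (W₂ : Walk (graph R) m z) →
               IsHWalk H R W₁ → IsHWalk H R W₂ → IsHWalk H R (W₁ ++ W₂)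
  ++-isHWalk _  _ _        hw-nil                 h₂ = h₂
  ++-isHWalk _  _ []       (hw-one e)             _  = hw-one e
  ++-isHWalk jm _ (e′ ∷ p) (hw-one e)             h₂ = hw-cons e e′ p (jm e e′) h₂
  ++-isHWalk jm _ W₂       (hw-cons e e′ p h h₁)  h₂ =
    hw-cons e e′ (p ++ W₂) h (++-isHWalk jm (e′ ∷ p) W₂ h₁ h₂)

module _ (H D : Digraph) (InG : SubArcs D)
         (c : ∀ {x y} → RArc D InG x y → Vertex H)
         (sc : SubdivisionColouring H D InG c) where

  subdivisionVertex-junction : (b : ArcG D InG) → Junction (RColored H D InG c) (inj₂ b)
  subdivisionVertex-junction _ (arc-in a g) (arc-out .a .g) with sc a g
  ... | hw-cons _ _ _ adjacent _ = adjacent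

mainTheorem11 : (H D : Digraph) → Loopless D →
    (InG : SubArcs D) → OutDegreeCondition D InG →
    (c : ∀ {x y} → RArc D InG x y → Vertex H) → SubdivisionColouring H D InG c →
    ∀ (a : RVertex D InG) (b : ArcG D InG) (c′ : RVertex D InG)
      (W₁ : Walk (RDigraph D InG) a (inj₂ b))
      (W₂ : Walk (RDigraph D InG) (inj₂ b) c′) →
    IsHWalk H (RColored H D InG c) W₁ →
    IsHWalk H (RColored H D InG c) W₂ →
    IsHWalk H (RColored H D InG c) (W₁ ++ W₂)
mainTheorem11 H D _ InG _ c sc _ b _ =
  ++-isHWalk (RColored H D InG c) (subdivisionVertex-junction H D InG c sc b)
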